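{- Let $n\in\{0,1,2,\ldots\}$ and let $f$ be a function (with values in $\mathbb{C}$) defined on $\{0,1,\ldots,n\}$ such that $f(j)=f(n-j)$ for all $j\in\{0,1,\ldots ,n\}$. Then \[ \sum_{j=0}^{n} \sum_{i=0}^j \binom{n+1}{i} f(j) = 2^{n} \sum_{j=0}^{n} f(j). \] -}

module Defs where

open import Level using (Level)
open import Data.Nat using (ℕ; zero; suc)
open import Algebra.Bundles using (CommutativeRing)
import Algebra.Properties.Monoid.Mult as Mult

module _ {c ℓ : Level} (R : CommutativeRing c ℓ) where
  open CommutativeRing R using (Carrier; _+_; +-monoid)

  -- ∑[ k = 0 .. m ] g k  =  g 0 + g 1 + ... + g m   (an inclusive range)
  sumUpTo : ℕ → (ℕ → Carrier) → Carrier
  sumUpTo zero    g = g zero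
  sumUpTo (suc m) g = sumUpTo m g + g (suc m)

  infixr 8 _·_
  _·_ : ℕ → Carrier → Carrier
  k · x = Mult._×_ +-monoid k x

module Submission where

-- Put N = n + 1 and let B k = C(N,0) + ... + C(N,k-1) be the
-- partial row sums of Pascal's triangle.  The inner sum of the left-hand
-- side is B (j + 1), so the left-hand side is the weighted sum
-- ∑_{j ≤ n} B (j + 1) · f j.  Two facts finish the proof.
--
--  * Arithmetic (in ℕ): complementary partial row sums add up to the whole
--    row, B a + B b = 2^N whenever a + b = N + 1; this follows from the
--    Pascal rule B_{N+1}(i+1) = B_N(i+1) + B_N(i) by induction on N.
--  * Pairing (in any commutative ring): if the weights satisfy
--    b i + b j = 2K and the values satisfy f i ≈ f j whenever i + j = n,
--    then ∑_{j ≤ n} b j · f j ≈ K · ∑_{j ≤ n} f j.  One peels off the two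
--    outermost terms and inducts; the middle term (n even) uses that
--    b + b = K + K forces b = K.  No division by 2 takes place in the ring.
--
-- The theorem is the pairing lemma with b j = B (j + 1) and K = 2^n.

open import Defs
open import Level using (Level)
import Data.Nat as ℕ
open import Data.Nat using (ℕ; _≤_; _∸_; _^_; suc; zero; _+_; ⌊_/2⌋)
open import Data.Nat.Combinatorics using (_C_; nCk+nC[k+1]≡[n+1]C[k+1]; k>n⇒nCk≡0)
open import Data.Nat.Properties
  using (+-comm; +-identityʳ; +-suc; suc-injective; n<1+n; m≤m+n; m+n∸m≡n; m+1+n≢0;
         n≡⌊n+n/2⌋)
  renaming (+-commutativeSemigroup to ℕ-+-commutativeSemigroup)
open import Data.Empty using (⊥-elim)
open import Function using (_∘_)
open import Relation.Binary.PropositionalEquality using (_≡_; refl; sym; trans; cong; cong₂; module ≡-Reasoning)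
open import Algebra.Bundles using (CommutativeRing)
import Algebra.Properties.CommutativeSemigroup as CommSemigroupProperties
import Algebra.Properties.CommutativeMonoid.Mult as CommMonoidMult

partialSum : (ℕ → ℕ) → ℕ → ℕ
partialSum a zero    = 0
partialSum a (suc k) = partialSum a k + a k

partialBinom : ℕ → ℕ → ℕ
partialBinom N = partialSum (N C_)

partialBinom-pascal : ∀ N i → partialBinom (suc N) (suc i) ≡ partialBinom N (suc i) + partialBinom N i
partialBinom-pascal N zero    = refl
partialBinom-pascal N (suc i) = begin
    partialBinom (suc N) (suc i) + suc N C suc i
      ≡⟨ cong₂ _+_ (partialBinom-pascal N i)
                   (trans (sym (nCk+nC[k+1]≡[n+1]C[k+1] N i)) (+-comm (N C i) (N C suc i))) ⟩
    (partialBinom N (suc i) + partialBinom N i) + (N C suc i + N C i)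
      ≡⟨ interchange (partialBinom N (suc i)) (partialBinom N i) (N C suc i) (N C i) ⟩
    (partialBinom N (suc i) + N C suc i) + (partialBinom N i + N C i) ∎
  where
    open ≡-Reasoning
    open CommSemigroupProperties ℕ-+-commutativeSemigroup using (interchange)

partialBinom-row : ∀ N → partialBinom N (suc N) ≡ 2 ^ N
partialBinom-row zero    = refl
partialBinom-row (suc N) = begin
    partialBinom (suc N) (suc (suc N))
      ≡⟨ partialBinom-pascal N (suc N) ⟩
    (partialBinom N (suc N) + N C suc N) + partialBinom N (suc N)
      ≡⟨ cong₂ _+_ (cong₂ _+_ (partialBinom-row N) (k>n⇒nCk≡0 (n<1+n N))) (partialBinom-row N) ⟩
    (2 ^ N + 0) + 2 ^ N
      ≡⟨ cong₂ _+_ (+-identityʳ (2 ^ N)) (sym (+-identityʳ (2 ^ N))) ⟩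
    2 ^ suc N ∎
  where open ≡-Reasoning

-- Complementary partial row sums make up the whole row:
-- the first i and the first j entries, with i + j = N + 1, cover row N exactly once.
partialBinom-complementary : ∀ N i j → i + j ≡ suc N → partialBinom N i + partialBinom N j ≡ 2 ^ N
partialBinom-complementary N       zero    .(suc N) refl = partialBinom-row N
partialBinom-complementary N       (suc i) zero     eq   =
  trans (+-identityʳ _)
        (trans (cong (partialBinom N) (trans (sym (+-identityʳ (suc i))) eq)) (partialBinom-row N))
partialBinom-complementary zero    (suc i) (suc j)  eq   = ⊥-elim (m+1+n≢0 i (suc-injective eq))
partialBinom-complementary (suc N) (suc i) (suc j)  eq   = begin
    partialBinom (suc N) (suc i) + partialBinom (suc N) (suc j)
      ≡⟨ cong₂ _+_ (partialBinom-pascal N i)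
                   (trans (partialBinom-pascal N j) (+-comm (partialBinom N (suc j)) (partialBinom N j))) ⟩
    (partialBinom N (suc i) + partialBinom N i) + (partialBinom N j + partialBinom N (suc j))
      ≡⟨ interchange (partialBinom N (suc i)) (partialBinom N i) (partialBinom N j) (partialBinom N (suc j)) ⟩
    (partialBinom N (suc i) + partialBinom N j) + (partialBinom N i + partialBinom N (suc j))
      ≡⟨ cong₂ _+_ (partialBinom-complementary N (suc i) j (cong suc i+j≡N))
                   (partialBinom-complementary N i (suc j) (trans (+-suc i j) (cong suc i+j≡N))) ⟩
    2 ^ N + 2 ^ N
      ≡⟨ cong (2 ^ N +_) (sym (+-identityʳ (2 ^ N))) ⟩
    2 ^ suc N ∎
  where
    open ≡-Reasoning
    open CommSemigroupProperties ℕ-+-commutativeSemigroup using (interchange)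
    i+j≡N : i + j ≡ N
    i+j≡N = suc-injective (trans (sym (+-suc i j)) (suc-injective eq))

double-injective : ∀ a b → a + a ≡ b + b → a ≡ b
double-injective a b eq = trans (n≡⌊n+n/2⌋ a) (trans (cong ⌊_/2⌋ eq) (sym (n≡⌊n+n/2⌋ b)))

module RingSums {c ℓ : Level} (R : CommutativeRing c ℓ) where
  open CommutativeRing R
    using (Carrier; _≈_; +-cong; +-congˡ; +-congʳ; +-commutativeMonoid; +-commutativeSemigroup; setoid)
    renaming (_+_ to _⊕_; refl to ≈-refl; sym to ≈-sym; trans to ≈-trans; reflexive to ≈-reflexive;
              +-assoc to ⊕-assoc)
  open CommSemigroupProperties +-commutativeSemigroup using (xy∙z≈xz∙y)
  open CommMonoidMult +-commutativeMonoid using (×-homo-+; ×-distrib-+; ×-congʳ; ×-congˡ)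
  open import Relation.Binary.Reasoning.Setoid setoid

  ∑ : ℕ → (ℕ → Carrier) → Carrier
  ∑ = sumUpTo R

  infixr 8 _·′_
  _·′_ : ℕ → Carrier → Carrier
  _·′_ = _·_ R

  ∑-cong : ∀ n {g h} → (∀ k → g k ≈ h k) → ∑ n g ≈ ∑ n h
  ∑-cong zero    g≈h = g≈h 0
  ∑-cong (suc n) g≈h = +-cong (∑-cong n g≈h) (g≈h (suc n))

  ∑-peel-first : ∀ n g → ∑ (suc n) g ≈ g 0 ⊕ ∑ n (g ∘ suc)
  ∑-peel-first zero    g = ≈-refl
  ∑-peel-first (suc n) g = begin
      ∑ (suc n) g ⊕ g (suc (suc n))          ≈⟨ +-congʳ (∑-peel-first n g) ⟩
      (g 0 ⊕ ∑ n (g ∘ suc)) ⊕ g (suc (suc n)) ≈⟨ ⊕-assoc _ _ _ ⟩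
      g 0 ⊕ ∑ (suc n) (g ∘ suc)              ∎

  ∑-peel-ends : ∀ n g → ∑ (suc (suc n)) g ≈ (g 0 ⊕ g (suc (suc n))) ⊕ ∑ n (g ∘ suc)
  ∑-peel-ends n g = begin
      ∑ (suc n) g ⊕ g (suc (suc n))           ≈⟨ +-congʳ (∑-peel-first n g) ⟩
      (g 0 ⊕ ∑ n (g ∘ suc)) ⊕ g (suc (suc n)) ≈⟨ xy∙z≈xz∙y _ _ _ ⟩
      (g 0 ⊕ g (suc (suc n))) ⊕ ∑ n (g ∘ suc) ∎

  ∑-multiples : ∀ (a : ℕ → ℕ) j x → ∑ j (λ i → a i ·′ x) ≈ partialSum a (suc j) ·′ x
  ∑-multiples a zero    x = ≈-refl
  ∑-multiples a (suc j) x = begin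
      ∑ j (λ i → a i ·′ x) ⊕ a (suc j) ·′ x      ≈⟨ +-congʳ (∑-multiples a j x) ⟩
      partialSum a (suc j) ·′ x ⊕ a (suc j) ·′ x ≈⟨ ≈-sym (×-homo-+ x (partialSum a (suc j)) (a (suc j))) ⟩
      partialSum a (suc (suc j)) ·′ x            ∎

  paired-terms : ∀ b b' K {x y} → b ℕ.+ b' ≡ K ℕ.+ K → x ≈ y → b ·′ x ⊕ b' ·′ y ≈ K ·′ (x ⊕ y)
  paired-terms b b' K {x} {y} weights x≈y = begin
      b ·′ x ⊕ b' ·′ y ≈⟨ +-congˡ (×-congʳ b' (≈-sym x≈y)) ⟩
      b ·′ x ⊕ b' ·′ x ≈⟨ ≈-sym (×-homo-+ x b b') ⟩
      (b ℕ.+ b') ·′ x  ≈⟨ ×-congˡ weights ⟩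
      (K ℕ.+ K) ·′ x   ≈⟨ ×-homo-+ x K K ⟩
      K ·′ x ⊕ K ·′ x  ≈⟨ +-congˡ (×-congʳ K x≈y) ⟩
      K ·′ x ⊕ K ·′ y  ≈⟨ ≈-sym (×-distrib-+ x y K) ⟩
      K ·′ (x ⊕ y)     ∎

  reflection-pairs : ∀ {n} (f : ℕ → Carrier) → (∀ j → j ≤ n → f j ≈ f (n ∸ j)) →
                     ∀ i j → i ℕ.+ j ≡ n → f i ≈ f j
  reflection-pairs f symmetric i j refl =
    ≈-trans (symmetric i (m≤m+n i j)) (≈-reflexive (cong f (m+n∸m≡n i j)))

  ∑-symmetric-pairing : ∀ n K (b : ℕ → ℕ) (f : ℕ → Carrier) →
    (∀ i j → i ℕ.+ j ≡ n → b i ℕ.+ b j ≡ K ℕ.+ K) →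
    (∀ i j → i ℕ.+ j ≡ n → f i ≈ f j) →
    ∑ n (λ k → b k ·′ f k) ≈ K ·′ ∑ n f
  ∑-symmetric-pairing zero          K b f weights values =
    ×-congˡ (double-injective (b 0) K (weights 0 0 refl))
  ∑-symmetric-pairing (suc zero)    K b f weights values =
    paired-terms (b 0) (b 1) K (weights 0 1 refl) (values 0 1 refl)
  ∑-symmetric-pairing (suc (suc n)) K b f weights values = begin
      ∑ (suc (suc n)) (λ k → b k ·′ f k)
        ≈⟨ ∑-peel-ends n _ ⟩
      (b 0 ·′ f 0 ⊕ b (suc (suc n)) ·′ f (suc (suc n))) ⊕ ∑ n (λ k → b (suc k) ·′ f (suc k))
        ≈⟨ +-cong (paired-terms (b 0) (b (suc (suc n))) K (weights 0 (suc (suc n)) refl)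
                                (values 0 (suc (suc n)) refl))
                  inner ⟩
      K ·′ (f 0 ⊕ f (suc (suc n))) ⊕ K ·′ ∑ n (f ∘ suc)
        ≈⟨ ≈-sym (×-distrib-+ (f 0 ⊕ f (suc (suc n))) (∑ n (f ∘ suc)) K) ⟩
      K ·′ ((f 0 ⊕ f (suc (suc n))) ⊕ ∑ n (f ∘ suc))
        ≈⟨ ×-congʳ K (≈-sym (∑-peel-ends n f)) ⟩
      K ·′ ∑ (suc (suc n)) f ∎
    where
      shift : ∀ {i j} → i ℕ.+ j ≡ n → suc i ℕ.+ suc j ≡ suc (suc n)
      shift {i} {j} e = cong suc (trans (+-suc i j) (cong suc e))
      inner : ∑ n (λ k → b (suc k) ·′ f (suc k)) ≈ K ·′ ∑ n (f ∘ suc)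
      inner = ∑-symmetric-pairing n K (b ∘ suc) (f ∘ suc)
                (λ i j e → weights (suc i) (suc j) (shift e))
                (λ i j e → values (suc i) (suc j) (shift e))

lemma10 : {c ℓ : Level} (R : CommutativeRing c ℓ) (n : ℕ) (f : ℕ → CommutativeRing.Carrier R) →
          (∀ j → j ≤ n → CommutativeRing._≈_ R (f j) (f (n ∸ j))) →
          CommutativeRing._≈_ R
            (sumUpTo R n (λ j → sumUpTo R j (λ i → _·_ R (suc n C i) (f j))))
            (_·_ R (2 ^ n) (sumUpTo R n f))
lemma10 R n f symmetric = begin
    ∑ n (λ j → ∑ j (λ i → (suc n C i) ·′ f j))
      ≈⟨ ∑-cong n (λ j → ∑-multiples (suc n C_) j (f j)) ⟩
    ∑ n (λ j → partialBinom (suc n) (suc j) ·′ f j)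
      ≈⟨ ∑-symmetric-pairing n (2 ^ n) (partialBinom (suc n) ∘ suc) f weights (reflection-pairs f symmetric) ⟩
    (2 ^ n) ·′ ∑ n f ∎
  where
    open RingSums R
    open CommutativeRing R using (setoid)
    open import Relation.Binary.Reasoning.Setoid setoid
    -- the weights B (i+1), B (j+1) of a reflected pair cover row n + 1: they sum to 2^(n+1)
    weights : ∀ i j → i + j ≡ n →
              partialBinom (suc n) (suc i) + partialBinom (suc n) (suc j) ≡ 2 ^ n + 2 ^ n
    weights i j e =
      trans (partialBinom-complementary (suc n) (suc i) (suc j) (cong suc (trans (+-suc i j) (cong suc e))))
            (cong (2 ^ n +_) (+-identityʳ (2 ^ n)))
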